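{- For every tree $T$ with at least two vertices, there is a quadrangulation of the sphere $\Sigma_0$ with graph $T[:]$ whose vertex chromatic number and face chromatic number are both equal to $2$.
   Context: The $2$-fold interlacement $T[:]$ of a graph $T$ has vertex set $\{v', v'' : v \in V(T)\}$; $v'$ and $v''$ are non-adjacent, and for each edge $vu$ of $T$ there are exactly the four edges $v'u', v'u'', v''u', v''u''$. A quadrangulation of a closed surface with a graph is an embedding in which every face is bounded by a simple cycle of length $4$ and every edge meets exactly two faces. The vertex chromatic number is the minimum number of colors in a proper vertex coloring of the graph; the face chromatic number of a quadrangulation is the minimum number of colors in a coloring of its faces such that any two faces meeting a common edge get different colors. -}

module Defs where

open import Data.Nat.Base using (ℕ; zero; suc; _+_; _*_; _≤_; _≤ᵇ_)
open import Data.Bool.Base using (Bool; true; false; if_then_else_)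
open import Data.Fin.Base using (Fin; toℕ; remQuot)
open import Data.Product.Base using (Σ; ∃; _×_; _,_; proj₁; proj₂; swap)
open import Data.List.Base using (List; []; _∷_; _++_; [_]; length; allFin; concatMap; map; upTo; foldr)
open import Data.List.Relation.Unary.Linked using (Linked)
open import Data.List.Relation.Unary.Unique.Propositional using (Unique)
open import Relation.Binary.PropositionalEquality using (_≡_; _≢_)
open import Relation.Nullary using (¬_)
open import Data.Empty using (⊥)

record SimpleGraph (n : ℕ) : Set where
  field
    adj    : Fin n → Fin n → Bool
    sym    : ∀ x y → adj x y ≡ adj y x
    irrefl : ∀ x → adj x x ≡ false
open SimpleGraph public

Adj : ∀ {n} → SimpleGraph n → Fin n → Fin n → Set
Adj G x y = adj G x y ≡ true

data Walk {n} (G : SimpleGraph n) : Fin n → Fin n → Set where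
  stay : ∀ {x} → Walk G x x
  step : ∀ {x y z} → Adj G x y → Walk G y z → Walk G x z

Connected : ∀ {n} → SimpleGraph n → Set
Connected G = ∀ x y → Walk G x y

IsCycle : ∀ {n} → SimpleGraph n → List (Fin n) → Set
IsCycle G []       = ⊥
IsCycle G (v ∷ vs) = 3 ≤ length (v ∷ vs) × Unique (v ∷ vs)
                     × Linked (Adj G) (v ∷ vs ++ [ v ])

Acyclic : ∀ {n} → SimpleGraph n → Set
Acyclic G = ∀ vs → ¬ IsCycle G vs

IsTree : ∀ {n} → SimpleGraph n → Set
IsTree G = Connected G × Acyclic G

-- The 2-fold interlacement T[:].  Vertex set Fin (n * 2) ≅ Fin n × Fin 2
-- (via remQuot / combine); (v , 0) is v' and (v , 1) is v''.
-- (v,i) ~ (u,j) iff v ~ u in T.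

base : ∀ {n} → Fin (n * 2) → Fin n
base {n} i = proj₁ (remQuot {n} 2 i)

interlace : ∀ {n} → SimpleGraph n → SimpleGraph (n * 2)
interlace T = record
  { adj    = λ i j → adj T (base i) (base j)
  ; sym    = λ i j → sym T (base i) (base j)
  ; irrefl = λ i → irrefl T (base i)
  }

VertexColouring : ∀ {n} → SimpleGraph n → ℕ → Set
VertexColouring {n} G k =
  Σ (Fin n → Fin k) λ c → ∀ x y → Adj G x y → c x ≢ c y

VertexChromaticNumberIs : ∀ {n} → SimpleGraph n → ℕ → Set
VertexChromaticNumberIs G zero    = VertexColouring G zero
VertexChromaticNumberIs G (suc k) = VertexColouring G (suc k) × ¬ VertexColouring G k

-- Cellular embeddings via rotation systems (combinatorial maps).
-- Face boundaries are the orbits of  φ d = rot (reverse d).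

Pair : ℕ → Set
Pair n = Fin n × Fin n

IsDart : ∀ {n} → SimpleGraph n → Pair n → Set
IsDart G (x , y) = Adj G x y

iter : ∀ {A : Set} → (A → A) → ℕ → A → A
iter f zero    a = a
iter f (suc k) a = f (iter f k a)

record RotationSystem {n} (G : SimpleGraph n) : Set where
  field
    rot      : Pair n → Pair n
    rot-dart : ∀ d → IsDart G d → IsDart G (rot d)
    rot-src  : ∀ d → IsDart G d → proj₁ (rot d) ≡ proj₁ d
    rot-inj  : ∀ d e → IsDart G d → IsDart G e → rot d ≡ rot e → d ≡ e
    rot-cyc  : ∀ x y z → Adj G x y → Adj G x z →
               ∃ λ k → iter rot k (x , y) ≡ (x , z)
open RotationSystem public

faceMap : ∀ {n} {G : SimpleGraph n} → RotationSystem G → Pair n → Pair n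
faceMap R d = rot R (swap d)

allB : ∀ {A : Set} → (A → Bool) → List A → Bool
allB p = foldr (λ a b → if p a then b else false) true

allPairs : ∀ n → List (Pair n)
allPairs n = concatMap (λ x → map (λ y → (x , y)) (allFin n)) (allFin n)

count : ∀ {A : Set} → (A → Bool) → List A → ℕ
count p []       = zero
count p (a ∷ as) = if p a then suc (count p as) else count p as

numDarts : ∀ {n} → SimpleGraph n → ℕ
numDarts {n} G = count (λ d → adj G (proj₁ d) (proj₂ d)) (allPairs n)

code : ∀ {n} → Pair n → ℕ
code {n} (x , y) = toℕ x * n + toℕ y

-- d is the representative (code-minimal element) of its face orbit
isFaceRep : ∀ {n} {G : SimpleGraph n} → RotationSystem G → Pair n → Bool
isFaceRep {G = G} R d =
  allB (λ k → code d ≤ᵇ code (iter (faceMap R) k d)) (upTo (numDarts G))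

numFaces : ∀ {n} {G : SimpleGraph n} → RotationSystem G → ℕ
numFaces {n} {G} R =
  count (λ d → if adj G (proj₁ d) (proj₂ d) then isFaceRep R d else false)
        (allPairs n)

-- The embedding is in the sphere Σ₀: Euler characteristic V − E + F = 2,
-- written without subtraction, with E = numDarts / 2:  2V + 2F = #darts + 4.
IsSpherical : ∀ {n} {G : SimpleGraph n} → RotationSystem G → Set
IsSpherical {n} {G} R = 2 * n + 2 * numFaces R ≡ numDarts G + 4

-- Quadrangulation: every face is bounded by a simple 4-cycle
-- (the face walk through d visits 4 distinct vertices and closes up after
-- 4 steps), and every edge meets exactly two faces (the two darts of an
-- edge lie in different faces).
src : ∀ {n} → Pair n → Fin n
src = proj₁

IsQuadrangulation : ∀ {n} {G : SimpleGraph n} → RotationSystem G → Set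
IsQuadrangulation {n} {G} R =
  (∀ d → IsDart G d →
     let φ = faceMap R
         v₀ = src d ; v₁ = src (φ d) ; v₂ = src (φ (φ d)) ; v₃ = src (φ (φ (φ d)))
     in iter φ 4 d ≡ d
        × v₀ ≢ v₁ × v₀ ≢ v₂ × v₀ ≢ v₃ × v₁ ≢ v₂ × v₁ ≢ v₃ × v₂ ≢ v₃)
  × (∀ d → IsDart G d → ∀ k → iter (faceMap R) k d ≢ swap d)

-- Face colourings: a colour per dart, constant along faces, and the two
-- faces meeting an edge get different colours.
FaceColouring : ∀ {n} {G : SimpleGraph n} → RotationSystem G → ℕ → Set
FaceColouring {n} {G} R k =
  Σ (Pair n → Fin k) λ c →
    (∀ d → IsDart G d → c (faceMap R d) ≡ c d)
    × (∀ d → IsDart G d → c d ≢ c (swap d))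

FaceChromaticNumberIs : ∀ {n} {G : SimpleGraph n} → RotationSystem G → ℕ → Set
FaceChromaticNumberIs R zero    = FaceColouring R zero
FaceChromaticNumberIs R (suc k) = FaceColouring R (suc k) × ¬ FaceColouring R k

-- A tree T on n ≥ 2 vertices has a leaf (otherwise it would carry an infinite
-- non-backtracking walk, which in a finite acyclic graph is impossible), and removing leaves
-- one by one shows that T is bipartite and has n − 1 edges.  Fix a cyclic order of the
-- neighbours of each vertex of T.  Around v′ let the darts of T[:] alternate u′, u″, next u′,
-- next u″, …, and around v″ alternate u″, u′, prev u″, prev u′, ….  Then every face is a
-- quadrangle v′ u′ v″ w″ with w the neighbour of v preceding u, and each dart v → u of T
-- yields exactly one face.  So T[:] has 2n vertices, 4(n − 1) edges and 2(n − 1) faces,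
-- Euler's formula gives the sphere, a 2-colouring of T colours the vertices of T[:], and
-- colouring the face v′ u′ v″ w″ by the colour of v colours the faces.

module Submission where

open import Defs hiding (sym)
open import Data.Bool.Base using (Bool; true; false; not; _∧_; if_then_else_)
import Data.Bool.Properties as Bool
open import Data.Empty using (⊥; ⊥-elim)
open import Data.Fin.Base using (Fin; zero; suc; toℕ; combine; remQuot)
open import Data.Fin.Instances
open import Data.Fin.Patterns using (0F; 1F)
open import Data.Fin.Properties
  using (any?; pigeonhole; toℕ<n; toℕ-combine; toℕ-injective; remQuot-combine; combine-remQuot)
open import Data.List.Base
  using (List; []; _∷_; _++_; [_]; filter; allFin; applyUpTo; upTo; length; map; concatMap; cartesianProduct)
open import Data.List.Extrema.Nat using (argmin; argmin-sel; f[argmin]≤f[xs])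
open import Data.List.Membership.Propositional using (_∈_)
open import Data.List.Membership.Propositional.Properties
  using (∈-allFin; ∈-filter⁺; ∈-filter⁻; ∈-cartesianProduct⁺; ∈-map⁺; ∈-map⁻; ∈-upTo⁺; ∈-upTo⁻)
open import Data.List.Properties using (length-applyUpTo; length-tabulate)
open import Data.List.Relation.Unary.All as All using (All; _∷_)
open import Data.List.Relation.Unary.Any using (here; there)
open import Data.List.Relation.Unary.Linked using (Linked; [-]; _∷_)
open import Data.List.Relation.Unary.Unique.Propositional using (Unique; _∷_)
import Data.List.Relation.Unary.Unique.Propositional.Properties as Unique
open import Data.Nat.Base using (ℕ; zero; suc; pred; _+_; _*_; _∸_; _≤_; _<_; s≤s; z≤n; NonZero)
open import Data.Nat.DivMod using (_%_; m%n<n; m%n%n≡m%n; %-distribˡ-+; [m+n]%n≡m%n; m<n⇒m%n≡m)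
open import Data.Nat.Properties
  using ( +-suc; +-assoc; +-comm; +-identityʳ; *-suc; *-comm; suc-injective; suc-pred; n≤1+n; n<1+n
        ; ≤-pred; ≤-trans; ≤-antisym; <⇒≤; ≤-<-trans; <-≤-trans; _≤?_; ≰⇒>; m≤n⇒m<n∨m≡n; m≤m+n
        ; m∸n≤m; m∸n+n≡m; m+[n∸m]≡n; +-∸-assoc; +-monoʳ-<; +-cancelʳ-<; +-cancelʳ-≤; *-monoʳ-≤
        ; ≤ᵇ⇒≤; ≤⇒≤ᵇ)
open import Data.Nat.Solver using (module +-*-Solver)
open import Data.Product.Base using (Σ; ∃; ∃₂; _×_; _,_; proj₁; proj₂; swap)
open import Data.Product.Instances
open import Data.Sum.Base using (_⊎_; inj₁; inj₂)
open import Function.Base using (id; _∘_; case_of_)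
open import Function.Bundles using (Equivalence; mk⇔)
open import Relation.Binary.PropositionalEquality hiding ([_])
open import Relation.Binary.Structures using (IsDecEquivalence)
open import Relation.Binary.TypeClasses using (_≟_)
open import Relation.Nullary using (¬_; Dec; yes; no)
open import Relation.Nullary.Decidable using (does; dec-true; dec-false)

module _ {A : Set} where

  count-ext : ∀ {p q : A → Bool} xs → (∀ a → a ∈ xs → p a ≡ q a) → count p xs ≡ count q xs
  count-ext [] _ = refl
  count-ext {p} {q} (x ∷ xs) p≗q with p x | q x | p≗q x (here refl)
  ... | true  | true  | _ = cong suc (count-ext xs λ a a∈ → p≗q a (there a∈))
  ... | false | false | _ = count-ext xs λ a a∈ → p≗q a (there a∈)

  count-split : ∀ (p q : A → Bool) xs →
                count p xs ≡ count (λ a → p a ∧ q a) xs + count (λ a → p a ∧ not (q a)) xs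
  count-split p q [] = refl
  count-split p q (x ∷ xs) with p x | q x
  ... | true  | true  = cong suc (count-split p q xs)
  ... | true  | false = trans (cong suc (count-split p q xs)) (sym (+-suc _ _))
  ... | false | _     = count-split p q xs

  count-true : ∀ (xs : List A) → count (λ _ → true) xs ≡ length xs
  count-true [] = refl
  count-true (x ∷ xs) = cong suc (count-true xs)

  count≡0 : ∀ (p : A → Bool) xs → (∀ a → a ∈ xs → p a ≡ false) → count p xs ≡ 0
  count≡0 p [] _ = refl
  count≡0 p (x ∷ xs) false-on rewrite false-on x (here refl) =
    count≡0 p xs λ a a∈ → false-on a (there a∈)

  count≡0⇒false : ∀ (p : A → Bool) xs → count p xs ≡ 0 → ∀ {a} → a ∈ xs → p a ≡ false
  count≡0⇒false p (x ∷ xs) c≡0 a∈ with p x in px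
  count≡0⇒false p (x ∷ xs) c≡0 (here refl) | false = px
  count≡0⇒false p (x ∷ xs) c≡0 (there a∈)  | false = count≡0⇒false p xs c≡0 a∈

  count>0 : ∀ (p : A → Bool) xs {a} → a ∈ xs → p a ≡ true → 0 < count p xs
  count>0 p xs a∈ pa with count p xs in c
  ... | zero with () ← trans (sym pa) (count≡0⇒false p xs c a∈)
  ... | suc _ = s≤s z≤n

  count>0⇒∃ : ∀ (p : A → Bool) xs → 0 < count p xs → ∃ λ a → a ∈ xs × p a ≡ true
  count>0⇒∃ p (x ∷ xs) c>0 with p x in px
  ... | true  = x , here refl , px
  ... | false with a , a∈ , pa ← count>0⇒∃ p xs c>0 = a , there a∈ , pa

module _ {A : Set} {{_ : IsDecEquivalence {A = A} _≡_}} where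

  infixl 6 _∖_

  _∖_ : (A → Bool) → A → (A → Bool)
  (p ∖ a) x = p x ∧ not (does (x ≟ a))

  ∖-≡ : ∀ p {a x} → x ≢ a → (p ∖ a) x ≡ p x
  ∖-≡ p {a} {x} x≢a rewrite dec-false (x ≟ a) x≢a = Bool.∧-identityʳ (p x)

  ∖-self : ∀ p a → (p ∖ a) a ≡ false
  ∖-self p a rewrite dec-true (a ≟ a) refl = Bool.∧-zeroʳ (p a)

  ∖⇒≢ : ∀ p {a x} → (p ∖ a) x ≡ true → x ≢ a
  ∖⇒≢ p {a} h refl with () ← trans (sym (∖-self p a)) h

  ∖-intro : ∀ p {a x} → p x ≡ true → x ≢ a → (p ∖ a) x ≡ true
  ∖-intro p px x≢a = trans (∖-≡ p x≢a) px

  ∖-elim : ∀ p {a x} → (p ∖ a) x ≡ true → p x ≡ true × x ≢ a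
  ∖-elim p h = trans (sym (∖-≡ p (∖⇒≢ p h))) h , ∖⇒≢ p h

  count-∖ : ∀ (p : A → Bool) {a} xs → Unique xs → a ∈ xs → p a ≡ true →
            count p xs ≡ suc (count (p ∖ a) xs)
  count-∖ p {a} (x ∷ xs) (x∉xs ∷ _) (here refl) pa rewrite pa | dec-true (a ≟ a) refl =
    cong suc (count-ext xs λ y y∈ → sym (∖-≡ p (≢-sym (All.lookup x∉xs y∈))))
  count-∖ p {a} (x ∷ xs) (x∉xs ∷ u) (there a∈) pa
    rewrite ∖-≡ p {a} {x} (λ { refl → All.lookup x∉xs a∈ refl }) with p x
  ... | true  = cong suc (count-∖ p xs u a∈ pa)
  ... | false = count-∖ p xs u a∈ pa

record Correspondence {A B : Set} (p : A → Bool) (q : B → Bool) : Set where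
  field
    to      : A → B
    from    : B → A
    to-q    : ∀ {a} → p a ≡ true → q (to a) ≡ true
    from-p  : ∀ {b} → q b ≡ true → p (from b) ≡ true
    from-to : ∀ {a} → p a ≡ true → from (to a) ≡ a
    to-from : ∀ {b} → q b ≡ true → to (from b) ≡ b

module _ {A B : Set} {{_ : IsDecEquivalence {A = A} _≡_}} {{_ : IsDecEquivalence {A = B} _≡_}} where

  restrict : ∀ {p : A → Bool} {q : B → Bool} (c : Correspondence p q) {a} → p a ≡ true →
             Correspondence (p ∖ a) (q ∖ Correspondence.to c a)
  restrict {p} {q} c {a} pa = record
    { to      = to
    ; from    = from
    ; to-q    = λ h → let px , x≢a = ∖-elim p h in
                  ∖-intro q (to-q px) λ e → x≢a (trans (sym (from-to px)) (trans (cong from e) (from-to pa)))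
    ; from-p  = λ h → let qy , y≢ = ∖-elim q h in
                  ∖-intro p (from-p qy) λ e → y≢ (trans (sym (to-from qy)) (cong to e))
    ; from-to = λ h → from-to (proj₁ (∖-elim p h))
    ; to-from = λ h → to-from (proj₁ (∖-elim q h))
    }
    where open Correspondence c

  module _ {xs : List A} {ys : List B} (xs-unique : Unique xs) (ys-unique : Unique ys)
           (∈-xs : ∀ a → a ∈ xs) (∈-ys : ∀ b → b ∈ ys) where

    count-correspondence : ∀ {p q} → Correspondence p q → count p xs ≡ count q ys
    count-correspondence {p} c = sym (go (count p xs) c refl)
      where
        go : ∀ {p q} k → Correspondence p q → count p xs ≡ k → count q ys ≡ k
        go {p} {q} zero c p≡0 = count≡0 q ys λ b _ → q-false b
          where
            open Correspondence c
            q-false : ∀ b → q b ≡ false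
            q-false b with q b in qb
            ... | false = refl
            ... | true with () ← trans (sym (from-p qb)) (count≡0⇒false p xs p≡0 (∈-xs (from b)))
        go {p} {q} (suc k) c p≡1+k with a , a∈ , pa ← count>0⇒∃ p xs (subst (0 <_) (sym p≡1+k) (s≤s z≤n)) =
          trans (count-∖ q ys ys-unique (∈-ys (to a)) (to-q pa))
                (cong suc (go k (restrict c pa)
                  (suc-injective (trans (sym (count-∖ p xs xs-unique a∈ pa)) p≡1+k))))
          where open Correspondence c

module _ {n : ℕ} where

  allFin-unique : Unique (allFin n)
  allFin-unique = Unique.allFin⁺ n

  private
    allPairs≡cartesianProduct : ∀ {A B : Set} (xs : List A) (ys : List B) →
                                concatMap (λ x → map (x ,_) ys) xs ≡ cartesianProduct xs ys
    allPairs≡cartesianProduct [] ys = refl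
    allPairs≡cartesianProduct (x ∷ xs) ys = cong (map (x ,_) ys ++_) (allPairs≡cartesianProduct xs ys)

  allPairs-unique : Unique (allPairs n)
  allPairs-unique = subst Unique (sym (allPairs≡cartesianProduct (allFin n) (allFin n)))
                          (Unique.cartesianProduct⁺ allFin-unique allFin-unique)

  ∈-allPairs : ∀ (d : Pair n) → d ∈ allPairs n
  ∈-allPairs (x , y) = subst ((x , y) ∈_) (sym (allPairs≡cartesianProduct (allFin n) (allFin n)))
                             (∈-cartesianProduct⁺ (∈-allFin x) (∈-allFin y))

module _ {n : ℕ} (G : SimpleGraph n) where

  Adj-sym : ∀ {x y} → Adj G x y → Adj G y x
  Adj-sym {x} {y} = trans (SimpleGraph.sym G y x)

  Adj-irrefl : ∀ {x} → ¬ Adj G x x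
  Adj-irrefl {x} h with () ← trans (sym (irrefl G x)) h

  Adj⇒≢ : ∀ {x y} → Adj G x y → x ≢ y
  Adj⇒≢ h refl = Adj-irrefl h

  neighboursIn : (Fin n → Bool) → Fin n → List (Fin n)
  neighboursIn P x = filter (λ y → P y ∧ adj G x y Bool.≟ true) (allFin n)

  neighboursIn-unique : ∀ P x → Unique (neighboursIn P x)
  neighboursIn-unique P x = Unique.filter⁺ _ allFin-unique

  ∈-neighboursIn⁺ : ∀ {P x y} → P y ≡ true → Adj G x y → y ∈ neighboursIn P x
  ∈-neighboursIn⁺ {P} {x} {y} Py xy = ∈-filter⁺ _ (∈-allFin y) (cong₂ _∧_ Py xy)

  ∈-neighboursIn⁻ : ∀ {P x y} → y ∈ neighboursIn P x → P y ≡ true × Adj G x y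
  ∈-neighboursIn⁻ {P} {x} {y} y∈ = Bool.∧-conicalˡ (P y) _ Py∧xy , Bool.∧-conicalʳ (P y) _ Py∧xy
    where Py∧xy = proj₂ (∈-filter⁻ _ {xs = allFin n} y∈)

  record NonBacktrackingWalk (f : ℕ → Fin n) : Set where
    field
      step-adj        : ∀ k → Adj G (f k) (f (suc k))
      nonbacktracking : ∀ k → f (2 + k) ≢ f k

  drop : ∀ {f} → NonBacktrackingWalk f → ∀ b → NonBacktrackingWalk (λ i → f (b + i))
  drop w zero = w
  drop w (suc b) = drop (record { step-adj = step-adj ∘ suc ; nonbacktracking = nonbacktracking ∘ suc }) b
    where open NonBacktrackingWalk w

  module _ (acyclic : Acyclic G) where

    closed-nonbacktracking-walk⇒⊥ : ∀ {f} → NonBacktrackingWalk f → ∀ m → 0 < m → f m ≡ f 0 →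
                                    (∀ {i j} → i < j → j < m → f i ≢ f j) → ⊥
    closed-nonbacktracking-walk⇒⊥ {f} w 1 _ closed _ = Adj-irrefl (subst (Adj G (f 0)) closed (step-adj 0))
      where open NonBacktrackingWalk w
    closed-nonbacktracking-walk⇒⊥ w 2 _ closed _ = nonbacktracking 0 closed
      where open NonBacktrackingWalk w
    closed-nonbacktracking-walk⇒⊥ {f} w m@(suc (suc (suc _))) _ closed distinct =
      acyclic (applyUpTo f m)
        ( subst (3 ≤_) (sym (length-applyUpTo f m)) (s≤s (s≤s (s≤s z≤n)))
        , Unique.applyUpTo⁺₁ f m distinct
        , subst (λ v → Linked (Adj G) (applyUpTo f m ++ [ v ])) closed (linked f m step-adj))
      where
        open NonBacktrackingWalk w
        linked : ∀ g m → (∀ k → Adj G (g k) (g (suc k))) → Linked (Adj G) (applyUpTo g m ++ [ g m ])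
        linked g zero g-adj = [-]
        linked g (suc zero) g-adj = g-adj 0 ∷ [-]
        linked g (suc (suc m)) g-adj = g-adj 0 ∷ linked (g ∘ suc) (suc m) (g-adj ∘ suc)

    -- a first repetition f x ≡ f y closes a walk f x … f y whose inner vertices are distinct
    nonbacktracking-walk-injective : ∀ {f} → NonBacktrackingWalk f → ∀ j {x y} → x < y → y ≤ j → f x ≢ f y
    nonbacktracking-walk-injective w zero (s≤s _) ()
    nonbacktracking-walk-injective {f} w (suc j) {x} {y} x<y y≤1+j with m≤n⇒m<n∨m≡n y≤1+j
    ... | inj₁ y<1+j = nonbacktracking-walk-injective w j x<y (≤-pred y<1+j)
    ... | inj₂ refl = λ fx≡fy →
      closed-nonbacktracking-walk⇒⊥ (drop w x) (suc j ∸ x)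
        (subst (0 <_) (sym (+-∸-assoc 1 (≤-pred x<y))) (s≤s z≤n))
        (trans (cong f (m+[n∸m]≡n x≤1+j)) (trans (sym fx≡fy) (cong f (sym (+-identityʳ x)))))
        λ {i} {i′} i<i′ i′<m → nonbacktracking-walk-injective w j (+-monoʳ-< x i<i′)
                                  (≤-pred (subst (x + i′ <_) (m+[n∸m]≡n x≤1+j) (+-monoʳ-< x i′<m)))
      where x≤1+j = ≤-pred (≤-trans x<y (n≤1+n _))

    ¬nonbacktracking-walk : ∀ {f} → ¬ NonBacktrackingWalk f
    ¬nonbacktracking-walk {f} w
      with i , j , i<j , fi≡fj ← pigeonhole (n<1+n n) (λ (i : Fin (suc n)) → f (toℕ i)) =
      nonbacktracking-walk-injective w n i<j (≤-pred (toℕ<n j)) fi≡fj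

module _ {A : Set} {{_ : IsDecEquivalence {A = A} _≡_}} where

  otherThan : A → List A → A
  otherThan u [] = u
  otherThan u (x ∷ []) = x
  otherThan u (x ∷ y ∷ _) = if does (x ≟ u) then y else x

  otherThan-spec : ∀ {u xs} → Unique xs → u ∈ xs → (∀ x → xs ≢ [ x ]) →
                   otherThan u xs ∈ xs × otherThan u xs ≢ u
  otherThan-spec {xs = x ∷ []} _ _ not-singleton = ⊥-elim (not-singleton x refl)
  otherThan-spec {u} {x ∷ y ∷ _} ((x≢y ∷ _) ∷ _) _ _ with x ≟ u
  ... | yes refl = there (here refl) , ≢-sym x≢y
  ... | no x≢u   = here refl , x≢u

module _ {n : ℕ} (T : SimpleGraph n) where

  data WalkIn (P : Fin n → Bool) : Fin n → Fin n → Set where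
    stay : ∀ {x} → WalkIn P x x
    step : ∀ {x y z} → Adj T x y → P y ≡ true → WalkIn P y z → WalkIn P x z

  ConnectedIn : (Fin n → Bool) → Set
  ConnectedIn P = ∀ {x y} → P x ≡ true → P y ≡ true → WalkIn P x y

  ProperIn : (Fin n → Bool) → (Fin n → Bool) → Set
  ProperIn P β = ∀ {x y} → P x ≡ true → P y ≡ true → Adj T x y → β x ≢ β y

  size : (Fin n → Bool) → ℕ
  size P = count P (allFin n)

  dartIn : (Fin n → Bool) → Pair n → Bool
  dartIn P d = P (proj₁ d) ∧ (P (proj₂ d) ∧ adj T (proj₁ d) (proj₂ d))

  dartsIn : (Fin n → Bool) → ℕ
  dartsIn P = count (dartIn P) (allPairs n)

  dartIn-intro : ∀ {P x y} → P x ≡ true → P y ≡ true → Adj T x y → dartIn P (x , y) ≡ true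
  dartIn-intro Px Py xy rewrite Px | Py = xy

  dartIn-elim : ∀ {P x y} → dartIn P (x , y) ≡ true → P x ≡ true × P y ≡ true × Adj T x y
  dartIn-elim {P} {x} {y} h with P x | P y
  ... | true | true = refl , refl , h

  record LeafIn (P : Fin n → Bool) (ℓ : Fin n) : Set where
    field
      member     : P ℓ ≡ true
      parent     : Fin n
      neighbours : neighboursIn T P ℓ ≡ [ parent ]

  leafIn? : ∀ P ℓ → Dec (LeafIn P ℓ)
  leafIn? P ℓ with P ℓ Bool.≟ true | neighboursIn T P ℓ in nbs
  ... | no ¬Pℓ | _         = no (¬Pℓ ∘ LeafIn.member)
  ... | yes Pℓ | []        = no λ leaf → case trans (sym nbs) (LeafIn.neighbours leaf) of λ ()
  ... | yes Pℓ | p ∷ []    = yes record { member = Pℓ ; parent = p ; neighbours = nbs }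
  ... | yes Pℓ | _ ∷ _ ∷ _ = no λ leaf → case trans (sym nbs) (LeafIn.neighbours leaf) of λ ()

  module _ (acyclic : Acyclic T) (P : Fin n → Bool) where

    leafless-edge⇒⊥ : (∀ ℓ → ¬ LeafIn P ℓ) → ∀ {a z} → P a ≡ true → P z ≡ true → Adj T a z → ⊥
    leafless-edge⇒⊥ leafless {a} {z} Pa Pz az = ¬nonbacktracking-walk T acyclic walk-nonbacktracking
      where
        next : Fin n → Fin n → Fin n
        next u v = otherThan u (neighboursIn T P v)

        walk : ℕ → Fin n × Fin n
        walk zero = a , z
        walk (suc k) = proj₂ (walk k) , next (proj₁ (walk k)) (proj₂ (walk k))

        f : ℕ → Fin n
        f = proj₁ ∘ walk

        next-spec : ∀ {u v} → P u ≡ true → P v ≡ true → Adj T v u →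
                    (P (next u v) ≡ true × Adj T v (next u v)) × next u v ≢ u
        next-spec {u} {v} Pu Pv vu =
          let next∈ , next≢u = otherThan-spec (neighboursIn-unique T P v) (∈-neighboursIn⁺ T Pu vu)
                                 λ p nbs → leafless v record { member = Pv ; parent = p ; neighbours = nbs }
          in ∈-neighboursIn⁻ T next∈ , next≢u

        invariant : ∀ k → P (f k) ≡ true × P (f (suc k)) ≡ true × Adj T (f k) (f (suc k))
        invariant zero = Pa , Pz , az
        invariant (suc k) =
          let Pfk , Pfk+1 , adjk = invariant k
              (Pnext , adjnext) , _ = next-spec Pfk Pfk+1 (Adj-sym T adjk)
          in Pfk+1 , Pnext , adjnext

        walk-nonbacktracking : NonBacktrackingWalk T f
        walk-nonbacktracking = record
          { step-adj        = λ k → proj₂ (proj₂ (invariant k))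
          ; nonbacktracking = λ k → let Pfk , Pfk+1 , adjk = invariant k in
                                    proj₂ (next-spec Pfk Pfk+1 (Adj-sym T adjk))
          }

    leafIn-exists : ∀ {a z} → P a ≡ true → P z ≡ true → Adj T a z → ∃ (LeafIn P)
    leafIn-exists Pa Pz az with any? (leafIn? P)
    ... | yes leaf = leaf
    ... | no ¬leaf = ⊥-elim (leafless-edge⇒⊥ (λ ℓ leaf → ¬leaf (ℓ , leaf)) Pa Pz az)

  module _ {P : Fin n → Bool} {ℓ : Fin n} (leaf : LeafIn P ℓ) where
    open LeafIn leaf

    parent-in : P parent ≡ true × Adj T ℓ parent
    parent-in = ∈-neighboursIn⁻ T (subst (parent ∈_) (sym neighbours) (here refl))

    only-neighbour : ∀ {z} → P z ≡ true → Adj T ℓ z → z ≡ parent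
    only-neighbour Pz ℓz with here z≡p ← subst (_ ∈_) neighbours (∈-neighboursIn⁺ T Pz ℓz) = z≡p

    walkIn-∖leaf : ∀ {x y} → WalkIn P x y → P x ≡ true → x ≢ ℓ → y ≢ ℓ → WalkIn (P ∖ ℓ) x y
    walkIn-∖leaf stay _ _ _ = stay
    walkIn-∖leaf (step {y = m} xm Pm w) Px x≢ℓ y≢ℓ with m ≟ ℓ
    walkIn-∖leaf (step xm Pm stay) _ _ y≢ℓ | yes refl = ⊥-elim (y≢ℓ refl)
    walkIn-∖leaf (step xℓ _ (step ℓz Pz w)) Px x≢ℓ y≢ℓ | yes refl =
      subst (λ v → WalkIn (P ∖ ℓ) v _) z≡x (walkIn-∖leaf w Pz (x≢ℓ ∘ trans (sym z≡x)) y≢ℓ)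
      where z≡x = trans (only-neighbour Pz ℓz) (sym (only-neighbour Px (Adj-sym T xℓ)))
    ... | no m≢ℓ = step xm (∖-intro P Pm m≢ℓ) (walkIn-∖leaf w Pm m≢ℓ y≢ℓ)

    connectedIn-∖leaf : ConnectedIn P → ConnectedIn (P ∖ ℓ)
    connectedIn-∖leaf connected Px Py =
      let Px′ , x≢ℓ = ∖-elim P Px ; Py′ , y≢ℓ = ∖-elim P Py
      in walkIn-∖leaf (connected Px′ Py′) Px′ x≢ℓ y≢ℓ

    size-∖leaf : size P ≡ suc (size (P ∖ ℓ))
    size-∖leaf = count-∖ P (allFin n) allFin-unique (∈-allFin ℓ) member

    -- the darts of P not in P ∖ ℓ are exactly the two orientations of the edge ℓ parent
    dartsIn-∖leaf : dartsIn P ≡ 2 + dartsIn (P ∖ ℓ)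
    dartsIn-∖leaf = begin
      count (dartIn P) (allPairs n)
        ≡⟨ count-∖ (dartIn P) _ allPairs-unique (∈-allPairs _) ℓp-in ⟩
      suc (count (dartIn P ∖ (ℓ , parent)) (allPairs n))
        ≡⟨ cong suc (count-∖ (dartIn P ∖ (ℓ , parent)) _ allPairs-unique (∈-allPairs _) pℓ-in) ⟩
      2 + count (dartIn P ∖ (ℓ , parent) ∖ (parent , ℓ)) (allPairs n)
        ≡⟨ cong (2 +_) (count-ext (allPairs n) λ d _ → other-darts d) ⟩
      2 + count (dartIn (P ∖ ℓ)) (allPairs n)
        ∎
      where
        open ≡-Reasoning
        Pp : P parent ≡ true
        Pp = proj₁ parent-in
        ℓp : Adj T ℓ parent
        ℓp = proj₂ parent-in
        ℓp-in : dartIn P (ℓ , parent) ≡ true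
        ℓp-in = dartIn-intro member Pp ℓp
        pℓ-in : (dartIn P ∖ (ℓ , parent)) (parent , ℓ) ≡ true
        pℓ-in = ∖-intro (dartIn P) (dartIn-intro Pp member (Adj-sym T ℓp)) (Adj⇒≢ T ℓp ∘ sym ∘ cong proj₁)
        other-darts : ∀ d → (dartIn P ∖ (ℓ , parent) ∖ (parent , ℓ)) d ≡ dartIn (P ∖ ℓ) d
        other-darts (x , y) = Bool.⇔→≡ {z = true} (mk⇔ to from)
          where
            to : (dartIn P ∖ (ℓ , parent) ∖ (parent , ℓ)) (x , y) ≡ true → dartIn (P ∖ ℓ) (x , y) ≡ true
            to h with h′ , ≢pℓ ← ∖-elim (dartIn P ∖ (ℓ , parent)) h
                 with d-in , ≢ℓp ← ∖-elim (dartIn P) h′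
                 with Px , Py , xy ← dartIn-elim {P} d-in =
              dartIn-intro (∖-intro P Px x≢ℓ) (∖-intro P Py y≢ℓ) xy
              where
                x≢ℓ : x ≢ ℓ
                x≢ℓ refl = ≢ℓp (cong (ℓ ,_) (only-neighbour Py xy))
                y≢ℓ : y ≢ ℓ
                y≢ℓ refl = ≢pℓ (cong (_, ℓ) (only-neighbour Px (Adj-sym T xy)))
            from : dartIn (P ∖ ℓ) (x , y) ≡ true → (dartIn P ∖ (ℓ , parent) ∖ (parent , ℓ)) (x , y) ≡ true
            from h =
              let Px′ , Py′ , xy = dartIn-elim {P ∖ ℓ} h
                  Px , x≢ℓ = ∖-elim P Px′
                  Py , y≢ℓ = ∖-elim P Py′
              in ∖-intro (dartIn P ∖ (ℓ , parent))
                         (∖-intro (dartIn P) (dartIn-intro Px Py xy) (x≢ℓ ∘ cong proj₁))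
                         (y≢ℓ ∘ cong proj₂)

    extend : (Fin n → Bool) → Fin n → Bool
    extend β z = if does (z ≟ ℓ) then not (β parent) else β z

    properIn-extend : ∀ {β} → ProperIn (P ∖ ℓ) β → ProperIn P (extend β)
    properIn-extend {β} proper {x} {y} Px Py xy with x ≟ ℓ | y ≟ ℓ
    ... | yes refl | yes refl = ⊥-elim (Adj-irrefl T xy)
    ... | yes refl | no y≢ℓ rewrite only-neighbour Py xy = Bool.not-¬ refl ∘ sym
    ... | no x≢ℓ | yes refl rewrite only-neighbour Px (Adj-sym T xy) = Bool.not-¬ refl
    ... | no x≢ℓ | no y≢ℓ = proper (∖-intro P Px x≢ℓ) (∖-intro P Py y≢ℓ) xy

  size≡1⇒≡ : ∀ {P x y} → size P ≡ 1 → P x ≡ true → P y ≡ true → x ≡ y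
  size≡1⇒≡ {P} {x} {y} size≡1 Px Py with y ≟ x
  ... | yes y≡x = sym y≡x
  ... | no y≢x =
    case trans (sym (∖-intro P Py y≢x)) (count≡0⇒false (P ∖ x) (allFin n) rest≡0 (∈-allFin y)) of λ ()
    where
      rest≡0 : size (P ∖ x) ≡ 0
      rest≡0 = suc-injective (trans (sym (count-∖ P (allFin n) allFin-unique (∈-allFin x) Px)) size≡1)

  module _ (acyclic : Acyclic T) where

    leafIn-of-size≥2 : ∀ {P k} → size P ≡ 2 + k → ConnectedIn P → ∃ (LeafIn P)
    leafIn-of-size≥2 {P} size≡ connected
      with a , a∈ , Pa ← count>0⇒∃ P (allFin n) (subst (0 <_) (sym size≡) (s≤s z≤n))
      with b , _ , Pb∖a ← count>0⇒∃ (P ∖ a) (allFin n)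
                            (subst (0 <_) (sym (suc-injective (trans (sym (count-∖ P _ allFin-unique a∈ Pa)) size≡)))
                                   (s≤s z≤n))
      with Pb , b≢a ← ∖-elim P Pb∖a
      with connected Pa Pb
    ... | stay = ⊥-elim (b≢a refl)
    ... | step az Pz _ = leafIn-exists acyclic P Pa Pz az

    tree-dartsIn : ∀ k {P} → size P ≡ suc k → ConnectedIn P → dartsIn P + 2 ≡ 2 * suc k
    tree-dartsIn zero {P} size≡1 _ = cong (_+ 2) (count≡0 (dartIn P) (allPairs n) λ d _ → no-dart d)
      where
        no-dart : ∀ d → dartIn P d ≡ false
        no-dart (x , y) with dartIn P (x , y) in d-in
        ... | false = refl
        ... | true = let Px , Py , xy = dartIn-elim {P} d-in in ⊥-elim (Adj⇒≢ T xy (size≡1⇒≡ size≡1 Px Py))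
    tree-dartsIn (suc k) {P} size≡ connected with ℓ , leaf ← leafIn-of-size≥2 size≡ connected = begin
      dartsIn P + 2             ≡⟨ cong (_+ 2) (dartsIn-∖leaf leaf) ⟩
      2 + (dartsIn (P ∖ ℓ) + 2) ≡⟨ cong (2 +_) (tree-dartsIn k size′ (connectedIn-∖leaf leaf connected)) ⟩
      2 + 2 * suc k             ≡⟨ *-suc 2 (suc k) ⟨
      2 * suc (suc k)           ∎
      where
        open ≡-Reasoning
        size′ : size (P ∖ ℓ) ≡ suc k
        size′ = suc-injective (trans (sym (size-∖leaf leaf)) size≡)

    tree-properIn : ∀ k {P} → size P ≡ suc k → ConnectedIn P → ∃ (ProperIn P)
    tree-properIn zero size≡1 _ = (λ _ → true) , λ Px Py xy _ → Adj⇒≢ T xy (size≡1⇒≡ size≡1 Px Py)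
    tree-properIn (suc k) {P} size≡ connected with ℓ , leaf ← leafIn-of-size≥2 size≡ connected =
      let β , proper = tree-properIn k (suc-injective (trans (sym (size-∖leaf leaf)) size≡))
                                     (connectedIn-∖leaf leaf connected)
      in extend leaf β , properIn-extend leaf proper

  module _ (tree : IsTree T) {{_ : NonZero n}} where

    private
      size-all : size (λ _ → true) ≡ suc (pred n)
      size-all = trans (count-true (allFin n)) (trans (length-tabulate id) (sym (suc-pred n)))

      connectedIn-all : ConnectedIn (λ _ → true)
      connectedIn-all {x} {y} _ _ = walkIn (proj₁ tree x y)
        where
          walkIn : ∀ {x y} → Walk T x y → WalkIn (λ _ → true) x y
          walkIn stay = stay
          walkIn (step xy w) = step xy refl (walkIn w)

    tree-numDarts : numDarts T + 2 ≡ 2 * n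
    tree-numDarts = trans (tree-dartsIn (proj₂ tree) (pred n) size-all connectedIn-all) (cong (2 *_) (suc-pred n))

    tree-bipartite : ∃ λ (β : Fin n → Bool) → ∀ {x y} → Adj T x y → β x ≢ β y
    tree-bipartite = let β , proper = tree-properIn (proj₂ tree) (pred n) size-all connectedIn-all
                     in β , proper refl refl

    tree-numDarts>0 : 2 ≤ n → 0 < numDarts T
    tree-numDarts>0 2≤n = +-cancelʳ-≤ 2 1 (numDarts T)
      (subst (3 ≤_) (sym tree-numDarts) (≤-trans (s≤s (s≤s (s≤s z≤n))) (*-monoʳ-≤ 2 2≤n)))

    tree-dart : 2 ≤ n → ∃ (IsDart T)
    tree-dart 2≤n with d , _ , d-dart ← count>0⇒∃ _ (allPairs n) (tree-numDarts>0 2≤n) = d , d-dart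

[1+m%n]%n≡[1+m]%n : ∀ m n .{{_ : NonZero n}} → suc (m % n) % n ≡ suc m % n
[1+m%n]%n≡[1+m]%n m n = begin
  (1 + m % n) % n            ≡⟨ %-distribˡ-+ 1 (m % n) n ⟩
  (1 % n + m % n % n) % n    ≡⟨ cong (λ k → (1 % n + k) % n) (m%n%n≡m%n m n) ⟩
  (1 % n + m % n) % n        ≡⟨ %-distribˡ-+ 1 m n ⟨
  (1 + m) % n                ∎
  where open ≡-Reasoning

iter-suc : ∀ {A : Set} (f : A → A) k a → iter f (suc k) a ≡ iter f k (f a)
iter-suc f zero a = refl
iter-suc f (suc k) a = cong f (iter-suc f k a)

iter-+ : ∀ {A : Set} (f : A → A) i j a → iter f (i + j) a ≡ iter f i (iter f j a)
iter-+ f zero j a = refl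
iter-+ f (suc i) j a = cong f (iter-+ f i j a)

Reaches : ∀ {A : Set} → (A → A) → A → A → Set
Reaches f a b = ∃ λ k → iter f k a ≡ b

module _ {A : Set} {f : A → A} where

  reaches-≡ : ∀ {a b} → a ≡ b → Reaches f a b
  reaches-≡ a≡b = 0 , a≡b

  reaches-trans : ∀ {a b c} → Reaches f a b → Reaches f b c → Reaches f a c
  reaches-trans {a} (i , a↝b) (j , b↝c) =
    j + i , trans (iter-+ f j i a) (trans (cong (iter f j) a↝b) b↝c)

  reaches-simulate : ∀ {B : Set} {g : B → B} (h : B → A) → (∀ b → Reaches f (h b) (h (g b))) →
                     ∀ {b b′} → Reaches g b b′ → Reaches f (h b) (h b′)
  reaches-simulate h round (zero , refl) = reaches-≡ refl
  reaches-simulate {g = g} h round {b} (suc k , refl) =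
    reaches-trans (reaches-simulate h round (k , refl)) (round (iter g k b))

module _ {A : Set} {{_ : IsDecEquivalence {A = A} _≡_}} where

  indexOf : A → List A → ℕ
  indexOf u [] = 0
  indexOf u (x ∷ xs) = if does (x ≟ u) then 0 else suc (indexOf u xs)

  at : List A → ℕ → A → A
  at [] i d = d
  at (x ∷ xs) zero d = x
  at (x ∷ xs) (suc i) d = at xs i d

  at-indexOf : ∀ {u} xs d → u ∈ xs → at xs (indexOf u xs) d ≡ u
  at-indexOf {u} (x ∷ xs) d u∈ with x ≟ u | u∈
  ... | yes x≡u | _          = x≡u
  ... | no x≢u  | here u≡x   = ⊥-elim (x≢u (sym u≡x))
  ... | no _    | there u∈xs = at-indexOf xs d u∈xs

  indexOf<length : ∀ {u} xs → u ∈ xs → indexOf u xs < length xs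
  indexOf<length {u} (x ∷ xs) u∈ with x ≟ u | u∈
  ... | yes _   | _          = s≤s z≤n
  ... | no x≢u  | here u≡x   = ⊥-elim (x≢u (sym u≡x))
  ... | no _    | there u∈xs = s≤s (indexOf<length xs u∈xs)

  at∈ : ∀ xs {i} d → i < length xs → at xs i d ∈ xs
  at∈ (x ∷ xs) {zero} d _ = here refl
  at∈ (x ∷ xs) {suc i} d (s≤s i<) = there (at∈ xs d i<)

  indexOf-at : ∀ {xs} → Unique xs → ∀ {i} d → i < length xs → indexOf (at xs i d) xs ≡ i
  indexOf-at {x ∷ xs} _ {zero} d _ rewrite dec-true (x ≟ x) refl = refl
  indexOf-at {x ∷ xs} (x∉xs ∷ unique) {suc i} d (s≤s i<)
    rewrite dec-false (x ≟ at xs i d) (All.lookup x∉xs (at∈ xs d i<)) = cong suc (indexOf-at unique d i<)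

  indexOf-injective : ∀ xs {u w} → u ∈ xs → w ∈ xs → indexOf u xs ≡ indexOf w xs → u ≡ w
  indexOf-injective xs {u} u∈ w∈ eq =
    trans (sym (at-indexOf xs u u∈)) (trans (cong (λ i → at xs i u) eq) (at-indexOf xs u w∈))

  next : List A → A → A
  next [] u = u
  next xs@(_ ∷ _) u = at xs (suc (indexOf u xs) % length xs) u

  prev : List A → A → A
  prev xs = iter (next xs) (pred (length xs))

  private
    module Cons {x : A} {xs : List A} (unique : Unique (x ∷ xs)) where
      L = x ∷ xs
      D = length L

      next∈ : ∀ u → next L u ∈ L
      next∈ u = at∈ L u (m%n<n (suc (indexOf u L)) D)

      iter-next∈ : ∀ {u} → u ∈ L → ∀ k → iter (next L) k u ∈ L
      iter-next∈ u∈ zero = u∈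
      iter-next∈ u∈ (suc k) = next∈ _

      indexOf-iter-next : ∀ {u} → u ∈ L → ∀ k → indexOf (iter (next L) k u) L ≡ (indexOf u L + k) % D
      indexOf-iter-next {u} u∈ zero =
        sym (trans (cong (_% D) (+-identityʳ (indexOf u L))) (m<n⇒m%n≡m (indexOf<length L u∈)))
      indexOf-iter-next {u} u∈ (suc k) = begin
        indexOf (next L v) L          ≡⟨ indexOf-at unique _ (m%n<n (suc (indexOf v L)) D) ⟩
        suc (indexOf v L) % D         ≡⟨ cong (λ i → suc i % D) (indexOf-iter-next u∈ k) ⟩
        suc ((indexOf u L + k) % D) % D ≡⟨ [1+m%n]%n≡[1+m]%n (indexOf u L + k) D ⟩
        suc (indexOf u L + k) % D     ≡⟨ cong (_% D) (+-suc _ k) ⟨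
        (indexOf u L + suc k) % D     ∎
        where
          open ≡-Reasoning
          v = iter (next L) k u

      next-orbit : ∀ {u w} → u ∈ L → w ∈ L → Reaches (next L) u w
      next-orbit {u} {w} u∈ w∈ = k , indexOf-injective L (iter-next∈ u∈ k) w∈ (begin
        indexOf (iter (next L) k u) L ≡⟨ indexOf-iter-next u∈ k ⟩
        (p + ((D ∸ p) + q)) % D        ≡⟨ cong (_% D) (+-assoc p (D ∸ p) q) ⟨
        (p + (D ∸ p) + q) % D          ≡⟨ cong (λ i → (i + q) % D) (m+[n∸m]≡n (<⇒≤ (indexOf<length L u∈))) ⟩
        (D + q) % D                    ≡⟨ cong (_% D) (+-comm D q) ⟩
        (q + D) % D                    ≡⟨ [m+n]%n≡m%n q D ⟩
        q % D                          ≡⟨ m<n⇒m%n≡m (indexOf<length L w∈) ⟩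
        q                              ∎)
        where
          open ≡-Reasoning
          p = indexOf u L
          q = indexOf w L
          k = (D ∸ p) + q

      iter-next-length : ∀ {u} → u ∈ L → iter (next L) D u ≡ u
      iter-next-length {u} u∈ = indexOf-injective L (iter-next∈ u∈ D) u∈ (begin
        indexOf (iter (next L) D u) L ≡⟨ indexOf-iter-next u∈ D ⟩
        (indexOf u L + D) % D         ≡⟨ [m+n]%n≡m%n (indexOf u L) D ⟩
        indexOf u L % D               ≡⟨ m<n⇒m%n≡m (indexOf<length L u∈) ⟩
        indexOf u L                   ∎)
        where open ≡-Reasoning

  next∈ : ∀ {xs u} → Unique xs → u ∈ xs → next xs u ∈ xs
  next∈ {_ ∷ _} {u} unique _ = Cons.next∈ unique u

  iter-next∈ : ∀ {xs u} → Unique xs → u ∈ xs → ∀ k → iter (next xs) k u ∈ xs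
  iter-next∈ unique u∈ zero = u∈
  iter-next∈ unique u∈ (suc k) = next∈ unique (iter-next∈ unique u∈ k)

  prev∈ : ∀ {xs u} → Unique xs → u ∈ xs → prev xs u ∈ xs
  prev∈ {xs} unique u∈ = iter-next∈ unique u∈ (pred (length xs))

  prev-next : ∀ {xs u} → Unique xs → u ∈ xs → prev xs (next xs u) ≡ u
  prev-next {x ∷ xs} {u} unique u∈ =
    trans (sym (iter-suc (next (x ∷ xs)) (length xs) u)) (Cons.iter-next-length unique u∈)

  next-prev : ∀ {xs u} → Unique xs → u ∈ xs → next xs (prev xs u) ≡ u
  next-prev {_ ∷ _} unique u∈ = Cons.iter-next-length unique u∈

  next-orbit : ∀ {xs u w} → Unique xs → u ∈ xs → w ∈ xs → Reaches (next xs) u w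
  next-orbit {_ ∷ _} unique = Cons.next-orbit unique

  prev-orbit : ∀ {xs u w} → Unique xs → u ∈ xs → w ∈ xs → Reaches (prev xs) u w
  prev-orbit {xs} unique u∈ w∈ with k , w↝u ← next-orbit unique w∈ u∈ =
    k , trans (cong (iter (prev xs) k) (sym w↝u)) (undo k w∈)
    where
      undo : ∀ k {v} → v ∈ xs → iter (prev xs) k (iter (next xs) k v) ≡ v
      undo zero _ = refl
      undo (suc k) v∈ = trans (iter-suc (prev xs) k _)
        (trans (cong (iter (prev xs) k) (prev-next unique (iter-next∈ unique v∈ k))) (undo k v∈))


Fin1-trivial : ∀ (a b : Fin 1) → a ≡ b
Fin1-trivial zero zero = refl

¬vertexColouring1 : ∀ {m} {G : SimpleGraph m} d → IsDart G d → ¬ VertexColouring G 1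
¬vertexColouring1 (x , y) xy (c , proper) = proper x y xy (Fin1-trivial (c x) (c y))

code≡toℕ-combine : ∀ {m} (d : Pair m) → code d ≡ toℕ (combine (proj₁ d) (proj₂ d))
code≡toℕ-combine {m} (x , y) = trans (cong (_+ toℕ y) (*-comm (toℕ x) m)) (sym (toℕ-combine x y))

code-injective : ∀ {m} {d e : Pair m} → code d ≡ code e → d ≡ e
code-injective {m} {x , y} {x′ , y′} eq =
  trans (sym (remQuot-combine x y)) (trans (cong (remQuot m) combine≡) (remQuot-combine x′ y′))
  where
    combine≡ : combine x y ≡ combine x′ y′
    combine≡ = toℕ-injective
      (trans (sym (code≡toℕ-combine (x , y))) (trans eq (code≡toℕ-combine (x′ , y′))))

module _ {A : Set} where

  allB⇒ : ∀ (p : A → Bool) xs → allB p xs ≡ true → ∀ {a} → a ∈ xs → p a ≡ true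
  allB⇒ p (x ∷ xs) h a∈ with p x in px
  allB⇒ p (x ∷ xs) h (here refl) | true = px
  allB⇒ p (x ∷ xs) h (there a∈)  | true = allB⇒ p xs h a∈

  ⇒allB : ∀ (p : A → Bool) xs → (∀ {a} → a ∈ xs → p a ≡ true) → allB p xs ≡ true
  ⇒allB p [] _ = refl
  ⇒allB p (x ∷ xs) h rewrite h (here refl) = ⇒allB p xs (h ∘ there)

module _ {A : Set} (f : A → A) (weight : A → ℕ) where

  orbit4 : A → List A
  orbit4 a = map (λ i → iter f i a) (upTo 4)

  -- opaque: only the two lemmas below are needed, and normalising argmin is costly
  opaque
    leastOf4 : A → A
    leastOf4 a = argmin weight a (orbit4 a)

    leastOf4-≤ : ∀ a {i} → i < 4 → weight (leastOf4 a) ≤ weight (iter f i a)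
    leastOf4-≤ a i<4 =
      All.lookup (f[argmin]≤f[xs] {f = weight} a (orbit4 a)) (∈-map⁺ (λ i → iter f i a) (∈-upTo⁺ i<4))

    leastOf4-iter : ∀ a → ∃ λ i → i < 4 × leastOf4 a ≡ iter f i a
    leastOf4-iter a = selected (argmin-sel weight a (orbit4 a))
      where
        selected : ∀ {b} → b ≡ a ⊎ b ∈ orbit4 a → ∃ λ i → i < 4 × b ≡ iter f i a
        selected (inj₁ b≡a) = 0 , s≤s z≤n , b≡a
        selected (inj₂ b∈) with i , i∈ , b≡ ← ∈-map⁻ (λ i → iter f i a) b∈ =
          i , ∈-upTo⁻ i∈ , b≡

module _ {m : ℕ} {G : SimpleGraph m} (R : RotationSystem G) where

  faceMap-dart : ∀ {d} → IsDart G d → IsDart G (faceMap R d)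
  faceMap-dart {d} d-dart = rot-dart R (swap d) (Adj-sym G d-dart)

  faceColouring⇒swap∉face : ∀ {k} → FaceColouring R k →
                            ∀ d → IsDart G d → ∀ i → iter (faceMap R) i d ≢ swap d
  faceColouring⇒swap∉face (c , c-face , c-edge) d d-dart i eq =
    c-edge d d-dart (trans (sym (c-iter i)) (cong c eq))
    where
      iter-dart : ∀ i → IsDart G (iter (faceMap R) i d)
      iter-dart zero = d-dart
      iter-dart (suc i) = faceMap-dart (iter-dart i)
      c-iter : ∀ i → c (iter (faceMap R) i d) ≡ c d
      c-iter zero = refl
      c-iter (suc i) = trans (c-face _ (iter-dart i)) (c-iter i)

  ¬faceColouring1 : ∀ d → IsDart G d → ¬ FaceColouring R 1
  ¬faceColouring1 d d-dart (c , _ , c-edge) = c-edge d d-dart (Fin1-trivial (c d) (c (swap d)))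

  isFaceRep⇒ : ∀ {d} → isFaceRep R d ≡ true →
               ∀ {i} → i < numDarts G → code d ≤ code (iter (faceMap R) i d)
  isFaceRep⇒ rep i< =
    ≤ᵇ⇒≤ _ _ (Equivalence.from Bool.T-≡ (allB⇒ _ (upTo (numDarts G)) rep (∈-upTo⁺ i<)))

  ⇒isFaceRep : ∀ {d} → (∀ {i} → i < numDarts G → code d ≤ code (iter (faceMap R) i d)) →
               isFaceRep R d ≡ true
  ⇒isFaceRep least =
    ⇒allB _ (upTo (numDarts G)) λ i∈ → Equivalence.to Bool.T-≡ (≤⇒≤ᵇ (least (∈-upTo⁻ i∈)))

flip : Fin 2 → Fin 2
flip 0F = 1F
flip 1F = 0F

Distinct4 : ∀ {A : Set} → A → A → A → A → Set
Distinct4 a b c d = a ≢ b × a ≢ c × a ≢ d × b ≢ c × b ≢ d × c ≢ d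

distinct4-rotate : ∀ {A : Set} {a b c d : A} → Distinct4 a b c d → Distinct4 b c d a
distinct4-rotate (a≢b , a≢c , a≢d , b≢c , b≢d , c≢d) =
  b≢c , b≢d , ≢-sym a≢b , c≢d , ≢-sym a≢c , ≢-sym a≢d

distinct4-cong : ∀ {A : Set} {a b c d a′ b′ c′ d′ : A} → a ≡ a′ → b ≡ b′ → c ≡ c′ → d ≡ d′ →
                 Distinct4 a b c d → Distinct4 a′ b′ c′ d′
distinct4-cong refl refl refl refl distinct = distinct

bit : Bool → Fin 2
bit false = 0F
bit true = 1F

bit-injective : ∀ {a b} → bit a ≡ bit b → a ≡ b
bit-injective {false} {false} _ = refl
bit-injective {true} {true} _ = refl

-- n is a parameter because it cannot be recovered from the type Fin (n * 2)
module Layers (n : ℕ) where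

  layer : Fin (n * 2) → Fin 2
  layer x = proj₂ (remQuot {n} 2 x)

  vertex : Fin n → Fin 2 → Fin (n * 2)
  vertex = combine

  base-vertex : ∀ v i → base (vertex v i) ≡ v
  base-vertex v i = cong proj₁ (remQuot-combine v i)

  layer-vertex : ∀ v i → layer (vertex v i) ≡ i
  layer-vertex v i = cong proj₂ (remQuot-combine v i)

  vertex-base-layer : ∀ x → vertex (base x) (layer x) ≡ x
  vertex-base-layer = combine-remQuot {n} 2

  vertex-base : ∀ {x i} → layer x ≡ i → vertex (base x) i ≡ x
  vertex-base {x} refl = vertex-base-layer x

  vertex-injective : ∀ {v u i j} → vertex v i ≡ vertex u j → v ≡ u × i ≡ j
  vertex-injective {v} {u} {i} {j} eq =
    trans (sym (base-vertex v i)) (trans (cong base eq) (base-vertex u j)) ,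
    trans (sym (layer-vertex v i)) (trans (cong layer eq) (layer-vertex u j))


module _ {n : ℕ} (T : SimpleGraph n) where
  open Layers n

  private
    G : SimpleGraph (n * 2)
    G = interlace T

  neighbours : Fin n → List (Fin n)
  neighbours = neighboursIn T (λ _ → true)

  nextAt prevAt : Fin n → Fin n → Fin n
  nextAt v = next (neighbours v)
  prevAt v = prev (neighbours v)

  private
    ∈-nbrs : ∀ {v u} → Adj T v u → u ∈ neighbours v
    ∈-nbrs = ∈-neighboursIn⁺ T refl

  nextAt-adj : ∀ {v u} → Adj T v u → Adj T v (nextAt v u)
  nextAt-adj vu = proj₂ (∈-neighboursIn⁻ T (next∈ (neighboursIn-unique T _ _) (∈-nbrs vu)))

  prevAt-adj : ∀ {v u} → Adj T v u → Adj T v (prevAt v u)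
  prevAt-adj vu = proj₂ (∈-neighboursIn⁻ T (prev∈ (neighboursIn-unique T _ _) (∈-nbrs vu)))

  prevAt-nextAt : ∀ {v u} → Adj T v u → prevAt v (nextAt v u) ≡ u
  prevAt-nextAt vu = prev-next (neighboursIn-unique T _ _) (∈-nbrs vu)

  nextAt-prevAt : ∀ {v u} → Adj T v u → nextAt v (prevAt v u) ≡ u
  nextAt-prevAt vu = next-prev (neighboursIn-unique T _ _) (∈-nbrs vu)

  turn : Fin 2 → Fin n → Fin n → Fin n
  turn 0F = nextAt
  turn 1F = prevAt

  turn-adj : ∀ i {v u} → Adj T v u → Adj T v (turn i v u)
  turn-adj 0F = nextAt-adj
  turn-adj 1F = prevAt-adj

  turn-orbit : ∀ i {v u w} → Adj T v u → Adj T v w → Reaches (turn i v) u w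
  turn-orbit 0F vu vw = next-orbit (neighboursIn-unique T _ _) (∈-nbrs vu) (∈-nbrs vw)
  turn-orbit 1F vu vw = prev-orbit (neighboursIn-unique T _ _) (∈-nbrs vu) (∈-nbrs vw)

  -- around (v , i) the darts alternate (u , i) ↦ (u , flip i) ↦ (turn i v u , i):
  -- the neighbours of v′ are visited forwards, those of v″ backwards
  rotTarget : Fin n → Fin 2 → Fin n → Fin 2 → Fin (n * 2)
  rotTarget v 0F u 0F = vertex u 1F
  rotTarget v 0F u 1F = vertex (nextAt v u) 0F
  rotTarget v 1F u 1F = vertex u 0F
  rotTarget v 1F u 0F = vertex (prevAt v u) 1F

  rotate : Pair (n * 2) → Pair (n * 2)
  rotate (x , y) = x , rotTarget (base x) (layer x) (base y) (layer y)

  rotate-vertex : ∀ x u j → rotate (x , vertex u j) ≡ (x , rotTarget (base x) (layer x) u j)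
  rotate-vertex x u j rewrite base-vertex u j | layer-vertex u j = refl

  rotate-same-layer : ∀ x u → rotate (x , vertex u (layer x)) ≡ (x , vertex u (flip (layer x)))
  rotate-same-layer x u rewrite rotate-vertex x u (layer x) with layer x
  ... | 0F = refl
  ... | 1F = refl

  rotate-other-layer : ∀ x u →
                       rotate (x , vertex u (flip (layer x))) ≡ (x , vertex (turn (layer x) (base x) u) (layer x))
  rotate-other-layer x u rewrite rotate-vertex x u (flip (layer x)) with layer x
  ... | 0F = refl
  ... | 1F = refl

  layer-cases : ∀ (i j : Fin 2) → j ≡ i ⊎ j ≡ flip i
  layer-cases 0F 0F = inj₁ refl
  layer-cases 0F 1F = inj₂ refl
  layer-cases 1F 0F = inj₂ refl
  layer-cases 1F 1F = inj₁ refl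

  rotTarget-adj : ∀ {v u} i j → Adj T v u → Adj T v (base (rotTarget v i u j))
  rotTarget-adj {v} {u} 0F 0F vu = subst (Adj T v) (sym (base-vertex u _)) vu
  rotTarget-adj {v} {u} 0F 1F vu = subst (Adj T v) (sym (base-vertex _ _)) (nextAt-adj vu)
  rotTarget-adj {v} {u} 1F 1F vu = subst (Adj T v) (sym (base-vertex u _)) vu
  rotTarget-adj {v} {u} 1F 0F vu = subst (Adj T v) (sym (base-vertex _ _)) (prevAt-adj vu)

  rotTarget-injective : ∀ {v u u′} i j j′ → Adj T v u → Adj T v u′ →
                        rotTarget v i u j ≡ rotTarget v i u′ j′ → u ≡ u′ × j ≡ j′
  rotTarget-injective 0F 0F 0F _ _ eq = proj₁ (vertex-injective eq) , refl
  rotTarget-injective {v} 0F 1F 1F vu vu′ eq =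
    trans (sym (prevAt-nextAt vu))
          (trans (cong (prevAt v) (proj₁ (vertex-injective eq))) (prevAt-nextAt vu′)) , refl
  rotTarget-injective 1F 1F 1F _ _ eq = proj₁ (vertex-injective eq) , refl
  rotTarget-injective {v} 1F 0F 0F vu vu′ eq =
    trans (sym (nextAt-prevAt vu))
          (trans (cong (nextAt v) (proj₁ (vertex-injective eq))) (nextAt-prevAt vu′)) , refl
  rotTarget-injective 0F 0F 1F _ _ eq with () ← proj₂ (vertex-injective eq)
  rotTarget-injective 0F 1F 0F _ _ eq with () ← proj₂ (vertex-injective eq)
  rotTarget-injective 1F 0F 1F _ _ eq with () ← proj₂ (vertex-injective eq)
  rotTarget-injective 1F 1F 0F _ _ eq with () ← proj₂ (vertex-injective eq)

  rotate-injective : ∀ d e → IsDart G d → IsDart G e → rotate d ≡ rotate e → d ≡ e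
  rotate-injective (x , y) (x′ , y′) xy xy′ eq with refl ← cong proj₁ eq
    with u≡u′ , j≡j′ ← rotTarget-injective (layer x) (layer y) (layer y′) xy xy′ (cong proj₂ eq) =
    cong (x ,_) (trans (sym (vertex-base-layer y)) (trans (cong₂ vertex u≡u′ j≡j′) (vertex-base-layer y′)))

  rotate-cyclic : ∀ x y z → Adj G x y → Adj G x z → Reaches rotate (x , y) (x , z)
  rotate-cyclic x y z xy xz =
    let a , va , y↝a = enter
        turns = reaches-simulate (λ u → x , vertex u i) two-steps (turn-orbit i va xz)
    in reaches-trans y↝a (reaches-trans turns leave)
    where
      i = layer x
      v = base x
      enter : ∃ λ a → Adj T v a × Reaches rotate (x , y) (x , vertex a i)
      enter with layer-cases i (layer y)
      ... | inj₁ j≡i  = base y , xy , reaches-≡ (cong (x ,_) (sym (vertex-base j≡i)))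
      ... | inj₂ j≡i′ = turn i v (base y) , turn-adj i xy , 1 ,
                         trans (cong (λ w → rotate (x , w)) (sym (vertex-base j≡i′))) (rotate-other-layer x (base y))
      two-steps : ∀ u → Reaches rotate (x , vertex u i) (x , vertex (turn i v u) i)
      two-steps u = 2 , trans (cong rotate (rotate-same-layer x u)) (rotate-other-layer x u)
      leave : Reaches rotate (x , vertex (base z) i) (x , z)
      leave with layer-cases i (layer z)
      ... | inj₁ j≡i  = reaches-≡ (cong (x ,_) (vertex-base j≡i))
      ... | inj₂ j≡i′ = 1 , trans (rotate-same-layer x (base z)) (cong (x ,_) (vertex-base j≡i′))

  interlaceRotation : RotationSystem G
  interlaceRotation = record
    { rot      = rotate
    ; rot-dart = λ { (x , y) xy → rotTarget-adj (layer x) (layer y) xy }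
    ; rot-src  = λ _ _ → refl
    ; rot-inj  = rotate-injective
    ; rot-cyc  = rotate-cyclic
    }

  private
    R : RotationSystem G
    R = interlaceRotation

    φ : Pair (n * 2) → Pair (n * 2)
    φ = faceMap R

  -- the k-th dart of the quadrangle v′ u′ v″ w″, where w = prevAt v u
  side : ℕ → Fin n → Fin n → Pair (n * 2)
  side 0 v u = vertex v 0F , vertex u 0F
  side 1 v u = vertex u 0F , vertex v 1F
  side 2 v u = vertex v 1F , vertex (prevAt v u) 1F
  side 3 v u = vertex (prevAt v u) 1F , vertex v 0F
  side (suc (suc (suc (suc k)))) v u = side k v u

  faceMap-vertex : ∀ v i u j → φ (vertex v i , vertex u j) ≡ (vertex u j , rotTarget u j v i)
  faceMap-vertex v i u j =
    trans (rotate-vertex (vertex u j) v i)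
          (cong₂ (λ w l → vertex u j , rotTarget w l v i) (base-vertex u j) (layer-vertex u j))

  faceMap-side : ∀ {v u} → Adj T v u → ∀ k → φ (side k v u) ≡ side (suc k) v u
  faceMap-side {v} {u} vu 0 = faceMap-vertex v 0F u 0F
  faceMap-side {v} {u} vu 1 = faceMap-vertex u 0F v 1F
  faceMap-side {v} {u} vu 2 = faceMap-vertex v 1F (prevAt v u) 1F
  faceMap-side {v} {u} vu 3 =
    trans (faceMap-vertex (prevAt v u) 1F v 0F) (cong (λ w → vertex v 0F , vertex w 0F) (nextAt-prevAt vu))
  faceMap-side vu (suc (suc (suc (suc k)))) = faceMap-side vu k

  iter-faceMap-side : ∀ {v u} → Adj T v u → ∀ i k → iter φ i (side k v u) ≡ side (i + k) v u
  iter-faceMap-side vu 0 k = refl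
  iter-faceMap-side vu (suc i) k = trans (cong φ (iter-faceMap-side vu i k)) (faceMap-side vu (i + k))

  side-isDart : ∀ {v u} → Adj T v u → ∀ k → IsDart G (side k v u)
  side-isDart {v} {u} vu 0 = trans (cong₂ (adj T) (base-vertex v _) (base-vertex u _)) vu
  side-isDart {v} {u} vu 1 = trans (cong₂ (adj T) (base-vertex u _) (base-vertex v _)) (Adj-sym T vu)
  side-isDart {v} {u} vu 2 = trans (cong₂ (adj T) (base-vertex v _) (base-vertex _ _)) (prevAt-adj vu)
  side-isDart {v} {u} vu 3 =
    trans (cong₂ (adj T) (base-vertex _ _) (base-vertex v _)) (Adj-sym T (prevAt-adj vu))
  side-isDart vu (suc (suc (suc (suc k)))) = side-isDart vu k

  dart⇒side : ∀ d → IsDart G d → ∃₂ λ v u → Adj T v u × ∃ λ k → k < 4 × d ≡ side k v u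
  dart⇒side (x , y) xy with layer x | vertex-base-layer x | layer y | vertex-base-layer y
  ... | 0F | x≡ | 0F | y≡ = base x , base y , xy , 0 , s≤s z≤n , sym (cong₂ _,_ x≡ y≡)
  ... | 0F | x≡ | 1F | y≡ = base y , base x , Adj-sym T xy , 1 , s≤s (s≤s z≤n) , sym (cong₂ _,_ x≡ y≡)
  ... | 1F | x≡ | 1F | y≡ =
    base x , nextAt (base x) (base y) , nextAt-adj xy , 2 , s≤s (s≤s (s≤s z≤n)) ,
    sym (cong₂ _,_ x≡ (trans (cong (λ w → vertex w 1F) (prevAt-nextAt xy)) y≡))
  ... | 1F | x≡ | 0F | y≡ =
    base y , nextAt (base y) (base x) , nextAt-adj (Adj-sym T xy) , 3 , s≤s (s≤s (s≤s (s≤s z≤n))) ,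
    sym (cong₂ _,_ (trans (cong (λ w → vertex w 1F) (prevAt-nextAt (Adj-sym T xy))) x≡) y≡)

  corner : ℕ → Fin n → Fin n → Fin (n * 2)
  corner k v u = proj₁ (side k v u)

  corners-distinct : ∀ {v u} → Adj T v u → ∀ k →
                     Distinct4 (corner k v u) (corner (1 + k) v u) (corner (2 + k) v u) (corner (3 + k) v u)
  corners-distinct vu 0 =
    (Adj⇒≢ T vu ∘ proj₁ ∘ vertex-injective) , layers≢ , layers≢ , layers≢ , layers≢ ,
    (Adj⇒≢ T (prevAt-adj vu) ∘ proj₁ ∘ vertex-injective)
    where
      layers≢ : ∀ {a b} → vertex a 0F ≢ vertex b 1F
      layers≢ eq with () ← proj₂ (vertex-injective eq)
  corners-distinct vu (suc k) = distinct4-rotate (corners-distinct vu k)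

  quadrangular-faces : ∀ d → IsDart G d →
                       iter φ 4 d ≡ d × Distinct4 (src d) (src (φ d)) (src (φ (φ d))) (src (φ (φ (φ d))))
  quadrangular-faces d d-dart with v , u , vu , k , _ , refl ← dart⇒side d d-dart =
    iter-faceMap-side vu 4 k ,
    distinct4-cong refl (corner-iter 1) (corner-iter 2) (corner-iter 3) (corners-distinct vu k)
    where
      corner-iter : ∀ i → corner (i + k) v u ≡ src (iter φ i (side k v u))
      corner-iter i = cong src (sym (iter-faceMap-side vu i k))

  module _ (β : Fin n → Bool) (β-proper : ∀ {x y} → Adj T x y → β x ≢ β y) where

    faceColour : Pair (n * 2) → Bool
    faceColour (x , y) = if does (layer x ≟ layer y) then β (base x) else not (β (base x))

    faceColour-vertex : ∀ v i u j →
                        faceColour (vertex v i , vertex u j) ≡ (if does (i ≟ j) then β v else not (β v))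
    faceColour-vertex v i u j rewrite layer-vertex v i | layer-vertex u j | base-vertex v i = refl

    faceColour-side : ∀ {v u} → Adj T v u → ∀ k → faceColour (side k v u) ≡ β v
    faceColour-side {v} {u} vu 0 = faceColour-vertex v 0F u 0F
    faceColour-side {v} {u} vu 1 =
      trans (faceColour-vertex u 0F v 1F) (sym (Bool.¬-not (β-proper vu)))
    faceColour-side {v} {u} vu 2 = faceColour-vertex v 1F (prevAt v u) 1F
    faceColour-side {v} {u} vu 3 =
      trans (faceColour-vertex (prevAt v u) 1F v 0F) (sym (Bool.¬-not (β-proper (prevAt-adj vu))))
    faceColour-side vu (suc (suc (suc (suc k)))) = faceColour-side vu k

    faceColour-faceMap : ∀ d → IsDart G d → faceColour (φ d) ≡ faceColour d
    faceColour-faceMap d d-dart with v , u , vu , k , _ , refl ← dart⇒side d d-dart =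
      trans (cong faceColour (faceMap-side vu k))
            (trans (faceColour-side vu (suc k)) (sym (faceColour-side vu k)))

    faceColour-swap : ∀ d → IsDart G d → faceColour d ≢ faceColour (swap d)
    faceColour-swap (x , y) xy with layer x ≟ layer y | layer y ≟ layer x
    ... | yes _ | yes _ = β-proper xy
    ... | no _  | no _  = β-proper xy ∘ Bool.not-injective
    ... | yes i≡j | no j≢i = ⊥-elim (j≢i (sym i≡j))
    ... | no i≢j | yes j≡i = ⊥-elim (i≢j (sym j≡i))

    vertexColouring-interlace : VertexColouring G 2
    vertexColouring-interlace = bit ∘ β ∘ base , λ _ _ xy → β-proper xy ∘ bit-injective

    faceColouring-interlace : FaceColouring R 2
    faceColouring-interlace = bit ∘ faceColour ,
                              (λ d d-dart → cong bit (faceColour-faceMap d d-dart)) ,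
                              (λ d d-dart → faceColour-swap d d-dart ∘ bit-injective)

  isLower : Fin 2 → Bool
  isLower 0F = true
  isLower 1F = false

  -- stated with not, so that splitting a count by isLower yields both layers definitionally
  isLayer : Fin 2 → Fin 2 → Bool
  isLayer 0F j = isLower j
  isLayer 1F j = not (isLower j)

  isLayer-refl : ∀ i → isLayer i i ≡ true
  isLayer-refl 0F = refl
  isLayer-refl 1F = refl

  isLayer⇒≡ : ∀ {i j} → isLayer i j ≡ true → j ≡ i
  isLayer⇒≡ {0F} {0F} _ = refl
  isLayer⇒≡ {1F} {1F} _ = refl
  isLayer⇒≡ {0F} {1F} ()
  isLayer⇒≡ {1F} {0F} ()

  ofLayers : Fin 2 → Fin 2 → Pair (n * 2) → Bool
  ofLayers i j d = (adj G (proj₁ d) (proj₂ d) ∧ isLayer i (layer (proj₁ d))) ∧ isLayer j (layer (proj₂ d))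

  ofLayers-intro : ∀ {v u} i j → Adj T v u → ofLayers i j (vertex v i , vertex u j) ≡ true
  ofLayers-intro {v} {u} i j vu
    rewrite base-vertex v i | base-vertex u j | layer-vertex v i | layer-vertex u j | vu
          | isLayer-refl i | isLayer-refl j = refl

  ofLayers-elim : ∀ {i j} d → ofLayers i j d ≡ true → ∃₂ λ v u → Adj T v u × d ≡ (vertex v i , vertex u j)
  ofLayers-elim {i} {j} (x , y) h
    with adj G x y in xy | isLayer i (layer x) in x-in | isLayer j (layer y) in y-in
  ... | true | true | true =
    base x , base y , xy , sym (cong₂ _,_ (vertex-base (isLayer⇒≡ x-in)) (vertex-base (isLayer⇒≡ y-in)))

  count-ofLayers : ∀ i j → count (ofLayers i j) (allPairs (n * 2)) ≡ numDarts T
  count-ofLayers i j = sym (count-correspondence allPairs-unique allPairs-unique ∈-allPairs ∈-allPairs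
    (record { to = to ; from = from ; to-q = ofLayers-intro i j ; from-p = from-p
            ; from-to = λ {d} _ → from-to d ; to-from = to-from }))
    where
      to : Pair n → Pair (n * 2)
      to (v , u) = vertex v i , vertex u j

      from : Pair (n * 2) → Pair n
      from (x , y) = base x , base y

      from-to : ∀ d → from (to d) ≡ d
      from-to (v , u) = cong₂ _,_ (base-vertex v i) (base-vertex u j)

      from-p : ∀ {e} → ofLayers i j e ≡ true → adj T (proj₁ (from e)) (proj₂ (from e)) ≡ true
      from-p {e} h with v , u , vu , refl ← ofLayers-elim {i} {j} e h =
        subst (λ d → Adj T (proj₁ d) (proj₂ d)) (sym (from-to (v , u))) vu

      to-from : ∀ {e} → ofLayers i j e ≡ true → to (from e) ≡ e
      to-from {e} h with v , u , vu , refl ← ofLayers-elim {i} {j} e h = cong to (from-to (v , u))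

  numDarts-interlace : numDarts G ≡ 4 * numDarts T
  numDarts-interlace = begin
    count (λ d → adj G (proj₁ d) (proj₂ d)) L
      ≡⟨ count-split _ (isLower ∘ layer ∘ proj₁) L ⟩
    count (λ d → adj G (proj₁ d) (proj₂ d) ∧ isLayer 0F (layer (proj₁ d))) L
      + count (λ d → adj G (proj₁ d) (proj₂ d) ∧ isLayer 1F (layer (proj₁ d))) L
      ≡⟨ cong₂ _+_ (count-split _ lower₂ L) (count-split _ lower₂ L) ⟩
    (count (ofLayers 0F 0F) L + count (ofLayers 0F 1F) L) + (count (ofLayers 1F 0F) L + count (ofLayers 1F 1F) L)
      ≡⟨ cong₂ _+_ (cong₂ _+_ (count-ofLayers 0F 0F) (count-ofLayers 0F 1F))
                   (cong₂ _+_ (count-ofLayers 1F 0F) (count-ofLayers 1F 1F)) ⟩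
    (D + D) + (D + D)
      ≡⟨ solve 1 (λ x → (x :+ x) :+ (x :+ x) := con 4 :* x) refl D ⟩
    4 * D
      ∎
    where
      open ≡-Reasoning
      open +-*-Solver
      L = allPairs (n * 2)
      D = numDarts T
      lower₂ : Pair (n * 2) → Bool
      lower₂ = isLower ∘ layer ∘ proj₂

  faceRep : Pair (n * 2) → Bool
  faceRep d = if adj G (proj₁ d) (proj₂ d) then isFaceRep R d else false

  faceRep-intro : ∀ {d} → IsDart G d → isFaceRep R d ≡ true → faceRep d ≡ true
  faceRep-intro d-dart rep rewrite d-dart = rep

  faceRep-elim : ∀ d → faceRep d ≡ true → IsDart G d × isFaceRep R d ≡ true
  faceRep-elim (x , y) h with adj G x y
  ... | true = refl , h

  mod4 : ℕ → ℕ
  mod4 (suc (suc (suc (suc k)))) = mod4 k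
  mod4 k = k

  mod4<4 : ∀ k → mod4 k < 4
  mod4<4 0 = s≤s z≤n
  mod4<4 1 = s≤s (s≤s z≤n)
  mod4<4 2 = s≤s (s≤s (s≤s z≤n))
  mod4<4 3 = s≤s (s≤s (s≤s (s≤s z≤n)))
  mod4<4 (suc (suc (suc (suc k)))) = mod4<4 k

  side-mod4 : ∀ k {v u} → side k v u ≡ side (mod4 k) v u
  side-mod4 0 = refl
  side-mod4 1 = refl
  side-mod4 2 = refl
  side-mod4 3 = refl
  side-mod4 (suc (suc (suc (suc k)))) = side-mod4 k

  side-reach : ∀ {v u} → Adj T v u → ∀ {k j} → k < 4 → j < 4 →
               ∃ λ i → i < 4 × iter φ i (side k v u) ≡ side j v u
  side-reach {v} {u} vu {k} {j} k<4 j<4 with k ≤? j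
  ... | yes k≤j = j ∸ k , ≤-<-trans (m∸n≤m j k) j<4 ,
                  trans (iter-faceMap-side vu (j ∸ k) k) (cong (λ m → side m v u) (m∸n+n≡m k≤j))
  ... | no k≰j = (4 + j) ∸ k ,
                 +-cancelʳ-< k _ 4 (subst (_< 4 + k) (sym i+k≡4+j) (+-monoʳ-< 4 (≰⇒> k≰j))) ,
                 trans (iter-faceMap-side vu ((4 + j) ∸ k) k) (cong (λ m → side m v u) i+k≡4+j)
    where
      i+k≡4+j : (4 + j) ∸ k + k ≡ 4 + j
      i+k≡4+j = m∸n+n≡m (≤-trans (<⇒≤ k<4) (m≤m+n 4 j))

  -- side k has layers (0,0), (0,1), (1,1), (1,0) for k = 0, 1, 2, 3,
  -- and (4 − k) mod 4 face steps lead from it back to side 0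
  stepsToFirst : Fin 2 → Fin 2 → ℕ
  stepsToFirst 0F 0F = 0
  stepsToFirst 0F 1F = 3
  stepsToFirst 1F 1F = 2
  stepsToFirst 1F 0F = 1

  firstSide : Pair (n * 2) → Pair (n * 2)
  firstSide d = iter φ (stepsToFirst (layer (proj₁ d)) (layer (proj₂ d))) d

  firstSide-side : ∀ {v u} → Adj T v u → ∀ {k} → k < 4 → firstSide (side k v u) ≡ side 0 v u
  firstSide-side {v} {u} vu {0} _ rewrite layer-vertex v 0F | layer-vertex u 0F = refl
  firstSide-side {v} {u} vu {1} _ rewrite layer-vertex u 0F | layer-vertex v 1F = iter-faceMap-side vu 3 1
  firstSide-side {v} {u} vu {2} _ rewrite layer-vertex v 1F | layer-vertex (prevAt v u) 1F =
    iter-faceMap-side vu 2 2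
  firstSide-side {v} {u} vu {3} _ rewrite layer-vertex (prevAt v u) 1F | layer-vertex v 0F =
    iter-faceMap-side vu 1 3
  firstSide-side _ {suc (suc (suc (suc _)))} (s≤s (s≤s (s≤s (s≤s ()))))

  least : Pair (n * 2) → Pair (n * 2)
  least = leastOf4 φ code

  least-side : ∀ {v u} → Adj T v u → ∃ λ j → j < 4 × least (side 0 v u) ≡ side j v u
  least-side {v} {u} vu with j , j<4 , least≡ ← leastOf4-iter φ code (side 0 v u) =
    j , j<4 , trans least≡ (trans (iter-faceMap-side vu j 0) (cong (λ m → side m v u) (+-identityʳ j)))

  least-side-≤ : ∀ {v u} → Adj T v u → ∀ m → code (least (side 0 v u)) ≤ code (side m v u)
  least-side-≤ {v} {u} vu m = subst (λ d → code (least (side 0 v u)) ≤ code d) side-m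
                                    (leastOf4-≤ φ code (side 0 v u) (mod4<4 m))
    where
      side-m : iter φ (mod4 m) (side 0 v u) ≡ side m v u
      side-m = trans (iter-faceMap-side vu (mod4 m) 0)
                     (trans (cong (λ k → side k v u) (+-identityʳ (mod4 m))) (sym (side-mod4 m)))

  isFaceRep-side-≤ : ∀ {v u} → Adj T v u → ∀ {k j} → k < 4 → j < 4 →
                     isFaceRep R (side k v u) ≡ true → code (side k v u) ≤ code (side j v u)
  isFaceRep-side-≤ {v} {u} vu {k} k<4 j<4 rep with i , i<4 , reach ← side-reach vu k<4 j<4 =
    subst (λ d → code (side k v u) ≤ code d) reach (isFaceRep⇒ R rep (<-≤-trans i<4 four≤N))
    where
      four≤N : 4 ≤ numDarts G
      four≤N = subst (4 ≤_) (sym numDarts-interlace)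
                     (*-monoʳ-≤ 4 (count>0 _ (allPairs n) (∈-allPairs (v , u)) vu))

  -- each face is counted once: by its least dart on the left, by its dart v′ u′ on the right
  numFaces-interlace : numFaces R ≡ numDarts T
  numFaces-interlace =
    trans (count-correspondence allPairs-unique allPairs-unique ∈-allPairs ∈-allPairs
                                (record { to = firstSide ; from = least ; to-q = to-q ; from-p = from-p
                                        ; from-to = from-to ; to-from = to-from }))
          (count-ofLayers 0F 0F)
    where
      to-q : ∀ {d} → faceRep d ≡ true → ofLayers 0F 0F (firstSide d) ≡ true
      to-q {d} rep with d-dart , _ ← faceRep-elim d rep
                   with v , u , vu , k , k<4 , refl ← dart⇒side d d-dart
        rewrite firstSide-side vu k<4 = ofLayers-intro 0F 0F vu

      from-p : ∀ {e} → ofLayers 0F 0F e ≡ true → faceRep (least e) ≡ true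
      from-p {e} h with v , u , vu , refl ← ofLayers-elim {0F} {0F} e h
                   with j , j<4 , least≡ ← least-side vu
        rewrite least≡ = faceRep-intro (side-isDart vu j) (⇒isFaceRep R λ {i} _ →
          subst₂ (λ a b → code a ≤ code b) least≡ (sym (iter-faceMap-side vu i j)) (least-side-≤ vu (i + j)))

      from-to : ∀ {d} → faceRep d ≡ true → least (firstSide d) ≡ d
      from-to {d} rep with d-dart , d-rep ← faceRep-elim d rep
                      with v , u , vu , k , k<4 , refl ← dart⇒side d d-dart
                      with j , j<4 , least≡ ← least-side vu
        rewrite firstSide-side vu k<4 | least≡ = code-injective (≤-antisym
          (subst (λ a → code a ≤ code (side k v u)) least≡ (least-side-≤ vu k))
          (isFaceRep-side-≤ vu k<4 j<4 d-rep))

      to-from : ∀ {e} → ofLayers 0F 0F e ≡ true → firstSide (least e) ≡ e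
      to-from {e} h with v , u , vu , refl ← ofLayers-elim {0F} {0F} e h
                    with j , j<4 , least≡ ← least-side vu
        rewrite least≡ = firstSide-side vu j<4

interlace-spherical : ∀ {n} (T : SimpleGraph n) → IsTree T → {{NonZero n}} → IsSpherical (interlaceRotation T)
interlace-spherical {n} T tree = begin
  2 * (n * 2) + 2 * numFaces (interlaceRotation T)
    ≡⟨ cong₂ (λ a b → 2 * a + 2 * b) (trans (*-comm n 2) (sym (tree-numDarts T tree))) (numFaces-interlace T) ⟩
  2 * (D + 2) + 2 * D
    ≡⟨ solve 1 (λ x → con 2 :* (x :+ con 2) :+ con 2 :* x := con 4 :* x :+ con 4) refl D ⟩
  4 * D + 4
    ≡⟨ cong (_+ 4) (numDarts-interlace T) ⟨
  numDarts (interlace T) + 4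
    ∎
  where
    open ≡-Reasoning
    open +-*-Solver
    D = numDarts T

corollary3p5 : (n : ℕ) (T : SimpleGraph n) → 2 ≤ n → IsTree T →
    Σ (RotationSystem (interlace T)) λ R →
    IsSpherical R × IsQuadrangulation R
    × VertexChromaticNumberIs (interlace T) 2 × FaceChromaticNumberIs R 2
corollary3p5 (suc (suc _)) T 2≤n@(s≤s (s≤s _)) tree =
  R , interlace-spherical T tree ,
  (quadrangular-faces T , faceColouring⇒swap∉face R faceColouring) ,
  (vertexColouring-interlace T β β-proper , ¬vertexColouring1 {G = interlace T} d₀ d₀-dart) ,
  (faceColouring , ¬faceColouring1 R d₀ d₀-dart)
  where
    R = interlaceRotation T
    β = proj₁ (tree-bipartite T tree)
    β-proper = proj₂ (tree-bipartite T tree)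
    faceColouring = faceColouring-interlace T β β-proper
    edge = tree-dart T tree 2≤n
    vu : Adj T (proj₁ (proj₁ edge)) (proj₂ (proj₁ edge))
    vu = proj₂ edge
    d₀ = side T 0 (proj₁ (proj₁ edge)) (proj₂ (proj₁ edge))
    d₀-dart : IsDart (interlace T) d₀
    d₀-dart = side-isDart T vu 0
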